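{- Suppose $Act=\{a\}$. Then the finite axiom system $\mathcal{E}_{v,1}'=\mathcal{E}_v\cup\{O1\}\cup\{V_1\}$, where $(O1)$ is $\mathit{yes}+\mathit{no}=\mathit{yes}+\mathit{no}+x$ and $(V_1)$ is $x=x+a.x$, is complete for verdict equivalence over open monitors: for all $m,n\in Mon_F$, if $m\simeq n$ then $\mathcal{E}_{v,1}'\vdash m=n$. In particular, verdict equivalence is finitely based when $Act=\{a\}$.
   Context: Let $Act$ be a set of visible actions, $\tau\notin Act$, and $Var$ a countably infinite set of variables disjoint from $Act\cup\{\tau\}$. Monitors $Mon_F$: $m,n ::= v \mid b.m \mid m+n \mid x$ ($b\in Act$, $x\in Var$), verdicts $v ::= \mathit{end}\mid \mathit{yes}\mid \mathit{no}$. Closed monitors contain no variables; (closed) substitutions map variables to (closed) monitors. Transitions: for $\alpha\in Act\cup\{\tau\}$, $\xrightarrow{\alpha}$ is the least relation with $b.m\xrightarrow{b}m$; if $m\xrightarrow{\alpha}m'$ then $m+n\xrightarrow{\alpha}m'$ and $n+m\xrightarrow{\alpha}m'$; and $v\xrightarrow{\alpha}v$ for every verdict $v$ and every $\alpha$. Weak transitions: $m\xRightarrow{\varepsilon}m'$ iff $m(\xrightarrow{\tau})^*m'$; $m\xRightarrow{b}m'$ iff $m\xRightarrow{\varepsilon}m_1\xrightarrow{b}m_2\xRightarrow{\varepsilon}m'$; $m\xRightarrow{bs'}m'$ ($s'\neq\varepsilon$) iff $m\xRightarrow{b}m_1\xRightarrow{s'}m'$. $L_a(m)=\{s\mid m\xRightarrow{s}\mathit{yes}\}$,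 $L_r(m)=\{s\mid m\xRightarrow{s}\mathit{no}\}$. Closed $m\simeq n$ iff $L_a(m)=L_a(n)$ and $L_r(m)=L_r(n)$; open $m\simeq n$ iff $\sigma(m)\simeq\sigma(n)$ for all closed substitutions $\sigma$. $\mathcal{E}\vdash m=n$: derivability by reflexivity, symmetry, transitivity, substitutivity and congruence for prefixing and $+$. A set of equations is a finite basis (finitely based) if it is finite, sound and complete. $\mathcal{E}_v$: (A1) $x+y=y+x$; (A2) $x+(y+z)=(x+y)+z$; (A3) $x+x=x$; (A4) $x+\mathit{end}=x$; for each $b\in Act$: $(E_b)$ $b.\mathit{end}=\mathit{end}$; $(Y_b)$ $\mathit{yes}=\mathit{yes}+b.\mathit{yes}$; $(N_b)$ $\mathit{no}=\mathit{no}+b.\mathit{no}$; $(D_b)$ $b.(x+y)=b.x+b.y$. -}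

module Defs where

open import Data.Nat using (ℕ)
open import Data.List using (List; []; _∷_)
open import Data.Maybe using (Maybe; just; nothing)
open import Data.Unit using (⊤; tt)
open import Data.Product using (_×_)
open import Function.Bundles using (_⇔_)

data Verdict : Set where
  end yes no : Verdict

module Monitors (Act : Set) where

  infixr 7 _·_
  infixl 6 _⊕_
  infix 4 _⊢_≈_ _≃_

  data Mon : Set where
    ver  : Verdict → Mon
    _·_  : Act → Mon → Mon
    _⊕_  : Mon → Mon → Mon
    var  : ℕ → Mon

  data Closed : Mon → Set where
    c-ver  : ∀ {v} → Closed (ver v)
    c-pre  : ∀ {b m} → Closed m → Closed (b · m)
    c-sum  : ∀ {m n} → Closed m → Closed n → Closed (m ⊕ n)

  Subst : Set
  Subst = ℕ → Mon

  ClosedSubst : Subst → Set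
  ClosedSubst σ = ∀ x → Closed (σ x)

  sub : Subst → Mon → Mon
  sub σ (ver v) = ver v
  sub σ (b · m) = b · sub σ m
  sub σ (m ⊕ n) = sub σ m ⊕ sub σ n
  sub σ (var x) = σ x

  -- labels α ∈ Act ∪ {τ}; τ is represented by nothing
  Label : Set
  Label = Maybe Act

  data Step : Mon → Label → Mon → Set where
    s-pre : ∀ {b m} → Step (b · m) (just b) m
    s-l   : ∀ {m n m' α} → Step m α m' → Step (m ⊕ n) α m'
    s-r   : ∀ {m n m' α} → Step m α m' → Step (n ⊕ m) α m'
    s-ver : ∀ {v α} → Step (ver v) α (ver v)

  data TauStar : Mon → Mon → Set where
    τ-refl : ∀ {m} → TauStar m m
    τ-step : ∀ {m m₁ m'} → Step m nothing m₁ → TauStar m₁ m' → TauStar m m'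

  data Weak : Mon → List Act → Mon → Set where
    w-ε    : ∀ {m m'} → TauStar m m' → Weak m [] m'
    w-cons : ∀ {m m₁ m₂ m' b s} → TauStar m m₁ → Step m₁ (just b) m₂ →
             Weak m₂ s m' → Weak m (b ∷ s) m'

  InLa : Mon → List Act → Set
  InLa m s = Weak m s (ver yes)

  InLr : Mon → List Act → Set
  InLr m s = Weak m s (ver no)

  ClosedEquiv : Mon → Mon → Set
  ClosedEquiv m n = (∀ s → InLa m s ⇔ InLa n s) × (∀ s → InLr m s ⇔ InLr n s)

  _≃_ : Mon → Mon → Set
  m ≃ n = ∀ (σ : Subst) → ClosedSubst σ → ClosedEquiv (sub σ m) (sub σ n)

  data _⊢_≈_ (Ax : Mon → Mon → Set) : Mon → Mon → Set where
    e-ax    : ∀ {l r} (σ : Subst) → Ax l r → Ax ⊢ sub σ l ≈ sub σ r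
    e-refl  : ∀ {m} → Ax ⊢ m ≈ m
    e-sym   : ∀ {m n} → Ax ⊢ m ≈ n → Ax ⊢ n ≈ m
    e-trans : ∀ {m n k} → Ax ⊢ m ≈ n → Ax ⊢ n ≈ k → Ax ⊢ m ≈ k
    e-pre   : ∀ {m n} (b : Act) → Ax ⊢ m ≈ n → Ax ⊢ b · m ≈ b · n
    e-sum   : ∀ {m m' n n'} → Ax ⊢ m ≈ m' → Ax ⊢ n ≈ n' → Ax ⊢ m ⊕ n ≈ m' ⊕ n'

  x y z : Mon
  x = var 0
  y = var 1
  z = var 2

  data Ev : Mon → Mon → Set where
    A1 : Ev (x ⊕ y) (y ⊕ x)
    A2 : Ev (x ⊕ (y ⊕ z)) ((x ⊕ y) ⊕ z)
    A3 : Ev (x ⊕ x) x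
    A4 : Ev (x ⊕ ver end) x
    E  : (b : Act) → Ev (b · ver end) (ver end)
    Y  : (b : Act) → Ev (ver yes) (ver yes ⊕ b · ver yes)
    N  : (b : Act) → Ev (ver no) (ver no ⊕ b · ver no)
    D  : (b : Act) → Ev (b · (x ⊕ y)) (b · x ⊕ b · y)

open Monitors ⊤ public

a : ⊤
a = tt

data Ev1' : Mon → Mon → Set where
  ev : ∀ {l r} → Ev l r → Ev1' l r
  O1 : Ev1' (ver yes ⊕ ver no) (ver yes ⊕ ver no ⊕ x)
  V1 : Ev1' x (x ⊕ a · x)

-- With the single action a, a trace is determined by its length, and since verdicts loop
-- a closed monitor reaches the verdict w along a trace of length d iff it has a summand
-- aᵉ.w with e ≤ d.  So its acceptance and rejection languages are determined by two numbers
-- of ℕ∞: the least depths of a yes and of a no.  Reading a monitor as a term of the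
-- (min, +1) algebra on ℕ∞ with end = ∞ and min (yes, no) = 0 validates every axiom, which
-- gives soundness.  For completeness let m ≼ n mean n = n + m; every monitor is the sum of
-- its atoms aᵈ.v and aᵈ.x, so it suffices to bound each atom of m by n.  Instantiating all
-- variables by end, or only x by yes (resp. no), shows that an atom aᵈ.v of m is matched
-- by an atom aᵉ.v of n with e ≤ d, and aᵈ.x either by some aᵉ.x, or by atoms aᵉ.yes and
-- aᵉ'.no with e, e' ≤ d.  V₁ (with Y and N) lets a shallower atom absorb a deeper one, and
-- O1 bounds x by yes + no.
module Submission where

open import Defs
open import Data.Empty using (⊥; ⊥-elim)
open import Data.List using ([]; _∷_; length; replicate)
open import Data.List.Properties using (length-replicate)
open import Data.Maybe using (just; nothing)
open import Data.Nat using (ℕ; zero; suc; _+_; _⊓_; _≤_; z≤n; s≤s)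
open import Data.Nat.Properties
  using (≤-refl; ≤-trans; n≤1+n; m≤n⇒m⊓n≡m; m⊓n≤m; m⊓n≤n; ⊓-sel; ⊓-assoc; ⊓-comm; ⊓-idem;
         +-identityʳ; +-suc; m+n≤o⇒m≤o)
  renaming (_≟_ to _≟ℕ_)
open import Data.Product using (_×_; _,_; proj₁; proj₂; ∃-syntax)
open import Data.Sum using (_⊎_; inj₁; inj₂)
open import Data.Unit using (tt)
open import Function using (_∘_; const)
open import Function.Bundles using (mk⇔; Equivalence)
open import Relation.Binary.PropositionalEquality
  using (_≡_; _≢_; refl; sym; trans; cong; cong₂; subst; module ≡-Reasoning)
open import Relation.Binary.Bundles using (Setoid)
import Relation.Binary.Reasoning.Setoid as SetoidReasoning
import Relation.Nullary.Decidable as Dec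

data ℕ∞ : Set where
  fin : ℕ → ℕ∞
  ∞   : ℕ∞

infixl 7 _⊓∞_
infix  4 _≤∞_

_⊓∞_ : ℕ∞ → ℕ∞ → ℕ∞
∞     ⊓∞ q     = q
fin m ⊓∞ ∞     = fin m
fin m ⊓∞ fin n = fin (m ⊓ n)

suc∞ : ℕ∞ → ℕ∞
suc∞ (fin n) = fin (suc n)
suc∞ ∞       = ∞

⊓∞-comm : ∀ p q → p ⊓∞ q ≡ q ⊓∞ p
⊓∞-comm ∞       ∞       = refl
⊓∞-comm ∞       (fin n) = refl
⊓∞-comm (fin m) ∞       = refl
⊓∞-comm (fin m) (fin n) = cong fin (⊓-comm m n)

⊓∞-assoc : ∀ p q r → p ⊓∞ (q ⊓∞ r) ≡ (p ⊓∞ q) ⊓∞ r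
⊓∞-assoc ∞       q       r       = refl
⊓∞-assoc (fin m) ∞       r       = refl
⊓∞-assoc (fin m) (fin n) ∞       = refl
⊓∞-assoc (fin m) (fin n) (fin k) = cong fin (sym (⊓-assoc m n k))

⊓∞-idem : ∀ p → p ⊓∞ p ≡ p
⊓∞-idem ∞       = refl
⊓∞-idem (fin m) = cong fin (⊓-idem m)

⊓∞-identityʳ : ∀ p → p ⊓∞ ∞ ≡ p
⊓∞-identityʳ ∞       = refl
⊓∞-identityʳ (fin m) = refl

⊓∞-zeroˡ : ∀ p → fin 0 ⊓∞ p ≡ fin 0
⊓∞-zeroˡ ∞       = refl
⊓∞-zeroˡ (fin m) = refl

suc∞-distrib-⊓∞ : ∀ p q → suc∞ (p ⊓∞ q) ≡ suc∞ p ⊓∞ suc∞ q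
suc∞-distrib-⊓∞ ∞       q       = refl
suc∞-distrib-⊓∞ (fin m) ∞       = refl
suc∞-distrib-⊓∞ (fin m) (fin n) = refl

p⊓∞suc∞p≡p : ∀ p → p ⊓∞ suc∞ p ≡ p
p⊓∞suc∞p≡p ∞       = refl
p⊓∞suc∞p≡p (fin m) = cong fin (m≤n⇒m⊓n≡m (n≤1+n m))

data _≤∞_ : ℕ∞ → ℕ∞ → Set where
  fin≤fin : ∀ {m n} → m ≤ n → fin m ≤∞ fin n
  _≤∞∞    : ∀ p → p ≤∞ ∞

≤∞-refl : ∀ {p} → p ≤∞ p
≤∞-refl {fin m} = fin≤fin ≤-refl
≤∞-refl {∞}     = ∞ ≤∞∞

≤∞-reflexive : ∀ {p q} → p ≡ q → p ≤∞ q
≤∞-reflexive refl = ≤∞-refl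

≤∞-trans : ∀ {p q r} → p ≤∞ q → q ≤∞ r → p ≤∞ r
≤∞-trans (fin≤fin m≤n) (fin≤fin n≤k) = fin≤fin (≤-trans m≤n n≤k)
≤∞-trans _             (q ≤∞∞)       = _ ≤∞∞

p≤∞suc∞p : ∀ p → p ≤∞ suc∞ p
p≤∞suc∞p (fin m) = fin≤fin (n≤1+n m)
p≤∞suc∞p ∞       = ∞ ≤∞∞

suc∞-mono-≤∞ : ∀ {p q} → p ≤∞ q → suc∞ p ≤∞ suc∞ q
suc∞-mono-≤∞ (fin≤fin m≤n) = fin≤fin (s≤s m≤n)
suc∞-mono-≤∞ (p ≤∞∞)       = _ ≤∞∞

p⊓∞q≤∞p : ∀ p q → p ⊓∞ q ≤∞ p
p⊓∞q≤∞p ∞       q       = q ≤∞∞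
p⊓∞q≤∞p (fin m) ∞       = ≤∞-refl
p⊓∞q≤∞p (fin m) (fin n) = fin≤fin (m⊓n≤m m n)

p⊓∞q≤∞q : ∀ p q → p ⊓∞ q ≤∞ q
p⊓∞q≤∞q ∞       q       = ≤∞-refl
p⊓∞q≤∞q (fin m) ∞       = _ ≤∞∞
p⊓∞q≤∞q (fin m) (fin n) = fin≤fin (m⊓n≤n m n)

⊓∞-≤∞-fin-cases : ∀ p q {d} → p ⊓∞ q ≤∞ fin d → p ≤∞ fin d ⊎ q ≤∞ fin d
⊓∞-≤∞-fin-cases ∞       q       le = inj₂ le
⊓∞-≤∞-fin-cases (fin m) ∞       le = inj₁ le
⊓∞-≤∞-fin-cases (fin m) (fin n) (fin≤fin le) with ⊓-sel m n
... | inj₁ m⊓n≡m = inj₁ (fin≤fin (subst (_≤ _) m⊓n≡m le))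
... | inj₂ m⊓n≡n = inj₂ (fin≤fin (subst (_≤ _) m⊓n≡n le))

suc∞p≰∞0 : ∀ {p} → suc∞ p ≤∞ fin 0 → ⊥
suc∞p≰∞0 {fin m} (fin≤fin ())

suc∞-≤∞-suc-inv : ∀ {p d} → suc∞ p ≤∞ fin (suc d) → p ≤∞ fin d
suc∞-≤∞-suc-inv {fin m} (fin≤fin (s≤s m≤d)) = fin≤fin m≤d

≤∞-fin-inv : ∀ {p d} → p ≤∞ fin d → ∃[ k ] p ≡ fin k × k ≤ d
≤∞-fin-inv (fin≤fin k≤d) = _ , refl , k≤d

-- Depth semantics

eval : (Verdict → ℕ∞) → (ℕ → ℕ∞) → Mon → ℕ∞
eval f ρ (ver v) = f v
eval f ρ (b · m) = suc∞ (eval f ρ m)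
eval f ρ (m ⊕ n) = eval f ρ m ⊓∞ eval f ρ n
eval f ρ (var i) = ρ i

eval-sub : ∀ f ρ σ m → eval f ρ (sub σ m) ≡ eval f (eval f ρ ∘ σ) m
eval-sub f ρ σ (ver v) = refl
eval-sub f ρ σ (b · m) = cong suc∞ (eval-sub f ρ σ m)
eval-sub f ρ σ (m ⊕ n) = cong₂ _⊓∞_ (eval-sub f ρ σ m) (eval-sub f ρ σ n)
eval-sub f ρ σ (var i) = refl

verdictDepth : Verdict → Verdict → ℕ∞
verdictDepth yes yes = fin 0
verdictDepth no  no  = fin 0
verdictDepth end end = fin 0
verdictDepth _   _   = ∞

verdictDepth-refl : ∀ w → verdictDepth w w ≡ fin 0
verdictDepth-refl yes = refl
verdictDepth-refl no  = refl
verdictDepth-refl end = refl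

verdictDepth-fin⇒≡ : ∀ w v {k} → verdictDepth w v ≡ fin k → v ≡ w
verdictDepth-fin⇒≡ yes yes _ = refl
verdictDepth-fin⇒≡ no  no  _ = refl
verdictDepth-fin⇒≡ end end _ = refl
verdictDepth-fin⇒≡ yes no  ()
verdictDepth-fin⇒≡ yes end ()
verdictDepth-fin⇒≡ no  yes ()
verdictDepth-fin⇒≡ no  end ()
verdictDepth-fin⇒≡ end yes ()
verdictDepth-fin⇒≡ end no  ()

-- The least length of a trace along which a closed monitor reaches w.
depth : Verdict → Mon → ℕ∞
depth w = eval (verdictDepth w) (const ∞)

depthUnder : Verdict → Subst → Mon → ℕ∞
depthUnder w σ = eval (verdictDepth w) (depth w ∘ σ)

depth-sub : ∀ w σ m → depth w (sub σ m) ≡ depthUnder w σ m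
depth-sub w σ = eval-sub (verdictDepth w) (const ∞) σ

step-depth : ∀ {m b m'} w → Step m (just b) m' → depth w m ≤∞ suc∞ (depth w m')
step-depth w s-pre            = ≤∞-refl
step-depth w (s-l {m} {n} st) = ≤∞-trans (p⊓∞q≤∞p (depth w m) (depth w n)) (step-depth w st)
step-depth w (s-r {m} {n} st) = ≤∞-trans (p⊓∞q≤∞q (depth w n) (depth w m)) (step-depth w st)
step-depth w (s-ver {v})      = p≤∞suc∞p (verdictDepth w v)

τ-depth : ∀ {m m'} w → Step m nothing m' → depth w m ≤∞ depth w m'
τ-depth w (s-l {m} {n} st) = ≤∞-trans (p⊓∞q≤∞p (depth w m) (depth w n)) (τ-depth w st)
τ-depth w (s-r {m} {n} st) = ≤∞-trans (p⊓∞q≤∞q (depth w n) (depth w m)) (τ-depth w st)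
τ-depth w s-ver            = ≤∞-refl

τ*-depth : ∀ {m m'} w → TauStar m m' → depth w m ≤∞ depth w m'
τ*-depth w τ-refl          = ≤∞-refl
τ*-depth w (τ-step st τ*) = ≤∞-trans (τ-depth w st) (τ*-depth w τ*)

weak⇒depth≤ : ∀ {m s w} → Weak m s (ver w) → depth w m ≤∞ fin (length s)
weak⇒depth≤ {w = w} (w-ε τ*) =
  ≤∞-trans (τ*-depth w τ*) (≤∞-reflexive (verdictDepth-refl w))
weak⇒depth≤ {w = w} (w-cons τ* st rest) =
  ≤∞-trans (τ*-depth w τ*) (≤∞-trans (step-depth w st) (suc∞-mono-≤∞ (weak⇒depth≤ rest)))

ver-weak : ∀ {w} s → Weak (ver w) s (ver w)
ver-weak []      = w-ε τ-refl
ver-weak (b ∷ s) = w-cons τ-refl s-ver (ver-weak s)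

-- If m is ver w itself, k reaches it through the lifted τ-loop of ver w.
weak-lift : ∀ {m k s w} → (∀ {α m'} → Step m α m' → Step k α m') →
            Weak m s (ver w) → Weak k s (ver w)
weak-lift lift (w-ε τ-refl)                     = w-ε (τ-step (lift s-ver) τ-refl)
weak-lift lift (w-ε (τ-step st τ*))             = w-ε (τ-step (lift st) τ*)
weak-lift lift (w-cons τ-refl st rest)          = w-cons τ-refl (lift st) rest
weak-lift lift (w-cons (τ-step st τ*) st' rest) = w-cons (τ-step (lift st) τ*) st' rest

depth≤⇒weak : ∀ m s w → depth w m ≤∞ fin (length s) → Weak m s (ver w)
depth≤⇒weak (ver v) s w le with ≤∞-fin-inv le
... | _ , eq , _ with verdictDepth-fin⇒≡ w v eq
...   | refl = ver-weak s
depth≤⇒weak (b · m) []      w le = ⊥-elim (suc∞p≰∞0 le)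
depth≤⇒weak (b · m) (c ∷ s) w le = w-cons τ-refl s-pre (depth≤⇒weak m s w (suc∞-≤∞-suc-inv le))
depth≤⇒weak (m ⊕ n) s w le with ⊓∞-≤∞-fin-cases (depth w m) (depth w n) le
... | inj₁ le-m = weak-lift s-l (depth≤⇒weak m s w le-m)
... | inj₂ le-n = weak-lift s-r (depth≤⇒weak n s w le-n)
depth≤⇒weak (var i) s w ()

depth-≡⇒weak : ∀ {m n s w} → depth w m ≡ depth w n → Weak m s (ver w) → Weak n s (ver w)
depth-≡⇒weak {n = n} {s} {w} eq reach =
  depth≤⇒weak n s w (subst (_≤∞ fin (length s)) eq (weak⇒depth≤ reach))

-- Soundness

IsModel : (Verdict → ℕ∞) → Set
IsModel f = f end ≡ ∞ × f yes ⊓∞ f no ≡ fin 0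

verdictDepth-model : ∀ w → w ≢ end → IsModel (verdictDepth w)
verdictDepth-model yes _     = refl , refl
verdictDepth-model no  _     = refl , refl
verdictDepth-model end w≢end = ⊥-elim (w≢end refl)

axiom-valid : ∀ {l r} → Ev1' l r → ∀ {f} → IsModel f → ∀ ρ → eval f ρ l ≡ eval f ρ r
axiom-valid (ev A1)     _              ρ = ⊓∞-comm (ρ 0) (ρ 1)
axiom-valid (ev A2)     _              ρ = ⊓∞-assoc (ρ 0) (ρ 1) (ρ 2)
axiom-valid (ev A3)     _              ρ = ⊓∞-idem (ρ 0)
axiom-valid (ev A4)     (end-∞ , _)    ρ rewrite end-∞ = ⊓∞-identityʳ (ρ 0)
axiom-valid (ev (E b))  (end-∞ , _)    ρ rewrite end-∞ = refl
axiom-valid (ev (Y b))  {f} _          ρ = sym (p⊓∞suc∞p≡p (f yes))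
axiom-valid (ev (N b))  {f} _          ρ = sym (p⊓∞suc∞p≡p (f no))
axiom-valid (ev (D b))  _              ρ = suc∞-distrib-⊓∞ (ρ 0) (ρ 1)
axiom-valid O1          (_ , yes⊓no-0) ρ rewrite yes⊓no-0 = sym (⊓∞-zeroˡ (ρ 0))
axiom-valid V1          _              ρ = sym (p⊓∞suc∞p≡p (ρ 0))

derivable-valid : ∀ {m n} → Ev1' ⊢ m ≈ n → ∀ {f} → IsModel f → ∀ ρ → eval f ρ m ≡ eval f ρ n
derivable-valid (e-ax {l} {r} σ ax) {f} model ρ =
  trans (eval-sub f ρ σ l) (trans (axiom-valid ax model _) (sym (eval-sub f ρ σ r)))
derivable-valid e-refl          model ρ = refl
derivable-valid (e-sym d)       model ρ = sym (derivable-valid d model ρ)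
derivable-valid (e-trans d d')  model ρ = trans (derivable-valid d model ρ) (derivable-valid d' model ρ)
derivable-valid (e-pre b d)     model ρ = cong suc∞ (derivable-valid d model ρ)
derivable-valid (e-sum d d')    model ρ = cong₂ _⊓∞_ (derivable-valid d model ρ) (derivable-valid d' model ρ)

derivable⇒depth-≡ : ∀ {m n} → Ev1' ⊢ m ≈ n → ∀ w → w ≢ end → ∀ σ →
                    depth w (sub σ m) ≡ depth w (sub σ n)
derivable⇒depth-≡ {m} {n} d w w≢end σ = begin
  depth w (sub σ m)   ≡⟨ depth-sub w σ m ⟩
  depthUnder w σ m    ≡⟨ derivable-valid d (verdictDepth-model w w≢end) (depth w ∘ σ) ⟩
  depthUnder w σ n    ≡⟨ depth-sub w σ n ⟨
  depth w (sub σ n)   ∎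
  where open ≡-Reasoning

soundness : ∀ (m n : Mon) → Ev1' ⊢ m ≈ n → m ≃ n
soundness m n d σ _ =
  (λ s → mk⇔ (depth-≡⇒weak eq-yes) (depth-≡⇒weak (sym eq-yes))) ,
  (λ s → mk⇔ (depth-≡⇒weak eq-no)  (depth-≡⇒weak (sym eq-no)))
  where
  eq-yes : depth yes (sub σ m) ≡ depth yes (sub σ n)
  eq-yes = derivable⇒depth-≡ d yes (λ ()) σ
  eq-no : depth no (sub σ m) ≡ depth no (sub σ n)
  eq-no = derivable⇒depth-≡ d no (λ ()) σ

infix 4 _≋_ _≼_

_≋_ : Mon → Mon → Set
m ≋ n = Ev1' ⊢ m ≈ n

≋-setoid : Setoid _ _
≋-setoid = record
  { Carrier       = Mon
  ; _≈_           = _≋_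
  ; isEquivalence = record { refl = e-refl ; sym = e-sym ; trans = e-trans }
  }

module EqReasoning = SetoidReasoning ≋-setoid

σ₃ : Mon → Mon → Mon → Subst
σ₃ p q r 0 = p
σ₃ p q r 1 = q
σ₃ p q r 2 = r
σ₃ p q r _ = p

⊕-comm : ∀ p q → p ⊕ q ≋ q ⊕ p
⊕-comm p q = e-ax (σ₃ p q p) (ev A1)

⊕-assoc : ∀ p q r → p ⊕ (q ⊕ r) ≋ (p ⊕ q) ⊕ r
⊕-assoc p q r = e-ax (σ₃ p q r) (ev A2)

⊕-idem : ∀ p → p ⊕ p ≋ p
⊕-idem p = e-ax (σ₃ p p p) (ev A3)

⊕-identityʳ : ∀ p → p ⊕ ver end ≋ p
⊕-identityʳ p = e-ax (σ₃ p p p) (ev A4)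

a·end≋end : a · ver end ≋ ver end
a·end≋end = e-ax (σ₃ x x x) (ev (E a))

a·-distrib-⊕ : ∀ p q → a · (p ⊕ q) ≋ a · p ⊕ a · q
a·-distrib-⊕ p q = e-ax (σ₃ p q p) (ev (D a))

_≼_ : Mon → Mon → Set
m ≼ n = n ≋ n ⊕ m

≼-refl : ∀ {m} → m ≼ m
≼-refl {m} = e-sym (⊕-idem m)

≼-trans : ∀ {m n k} → m ≼ n → n ≼ k → m ≼ k
≼-trans {m} {n} {k} m≼n n≼k = begin
  k             ≈⟨ n≼k ⟩
  k ⊕ n         ≈⟨ e-sum e-refl m≼n ⟩
  k ⊕ (n ⊕ m)   ≈⟨ ⊕-assoc k n m ⟩
  (k ⊕ n) ⊕ m   ≈⟨ e-sum (e-sym n≼k) e-refl ⟩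
  k ⊕ m         ∎
  where open EqReasoning

≋⇒≼ : ∀ {m n} → m ≋ n → m ≼ n
≋⇒≼ {m} {n} m≋n = e-trans (e-sym (⊕-idem n)) (e-sum e-refl (e-sym m≋n))

≼-antisym : ∀ {m n} → m ≼ n → n ≼ m → m ≋ n
≼-antisym {m} {n} m≼n n≼m = e-trans n≼m (e-trans (⊕-comm m n) (e-sym m≼n))

⊕-lub : ∀ {m n k} → m ≼ k → n ≼ k → m ⊕ n ≼ k
⊕-lub {m} {n} {k} m≼k n≼k = e-trans n≼k (e-trans (e-sum m≼k e-refl) (e-sym (⊕-assoc k m n)))

m≼m⊕n : ∀ {m n} → m ≼ m ⊕ n
m≼m⊕n {m} {n} = e-sym (begin
  (m ⊕ n) ⊕ m   ≈⟨ e-sym (⊕-assoc m n m) ⟩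
  m ⊕ (n ⊕ m)   ≈⟨ e-sum e-refl (⊕-comm n m) ⟩
  m ⊕ (m ⊕ n)   ≈⟨ ⊕-assoc m m n ⟩
  (m ⊕ m) ⊕ n   ≈⟨ e-sum (⊕-idem m) e-refl ⟩
  m ⊕ n         ∎)
  where open EqReasoning

n≼m⊕n : ∀ {m n} → n ≼ m ⊕ n
n≼m⊕n {m} {n} = e-sym (e-trans (e-sym (⊕-assoc m n n)) (e-sum e-refl (⊕-idem n)))

end≼ : ∀ {n} → ver end ≼ n
end≼ {n} = e-sym (⊕-identityʳ n)

a·-mono-≼ : ∀ {m n} → m ≼ n → a · m ≼ a · n
a·-mono-≼ {m} {n} m≼n = e-trans (e-pre a m≼n) (a·-distrib-⊕ n m)

yes-absorbs-a· : a · ver yes ≼ ver yes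
yes-absorbs-a· = e-ax (σ₃ x x x) (ev (Y a))

no-absorbs-a· : a · ver no ≼ ver no
no-absorbs-a· = e-ax (σ₃ x x x) (ev (N a))

var-absorbs-a· : ∀ i → a · var i ≼ var i
var-absorbs-a· i = e-ax (σ₃ (var i) x x) V1

≼-yes⊕no : ∀ p → p ≼ ver yes ⊕ ver no
≼-yes⊕no p = e-ax (σ₃ p x x) O1

prefix : ℕ → Mon → Mon
prefix zero    t = t
prefix (suc k) t = a · prefix k t

prefix-suc : ∀ k t → prefix k (a · t) ≡ prefix (suc k) t
prefix-suc zero    t = refl
prefix-suc (suc k) t = cong (a ·_) (prefix-suc k t)

prefix-mono-≼ : ∀ k {m n} → m ≼ n → prefix k m ≼ prefix k n
prefix-mono-≼ zero    m≼n = m≼n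
prefix-mono-≼ (suc k) m≼n = a·-mono-≼ (prefix-mono-≼ k m≼n)

prefix-distrib-⊕ : ∀ k m n → prefix k (m ⊕ n) ≋ prefix k m ⊕ prefix k n
prefix-distrib-⊕ zero    m n = e-refl
prefix-distrib-⊕ (suc k) m n = e-trans (e-pre a (prefix-distrib-⊕ k m n)) (a·-distrib-⊕ _ _)

prefix-end : ∀ k → prefix k (ver end) ≋ ver end
prefix-end zero    = e-refl
prefix-end (suc k) = e-trans (e-pre a (prefix-end k)) a·end≋end

prefix-absorbed : ∀ {t} → a · t ≼ t → ∀ k → prefix k t ≼ t
prefix-absorbed a·t≼t zero    = ≼-refl
prefix-absorbed a·t≼t (suc k) = ≼-trans (a·-mono-≼ (prefix-absorbed a·t≼t k)) a·t≼t

prefix-antitone : ∀ {t e d} → a · t ≼ t → e ≤ d → prefix d t ≼ prefix e t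
prefix-antitone {d = d} a·t≼t z≤n      = prefix-absorbed a·t≼t d
prefix-antitone         a·t≼t (s≤s e≤d) = a·-mono-≼ (prefix-antitone a·t≼t e≤d)

data Leaf : Set where
  ver-leaf : Verdict → Leaf
  var-leaf : ℕ → Leaf

leaf : Leaf → Mon
leaf (ver-leaf v) = ver v
leaf (var-leaf i) = var i

data Atom : Mon → ℕ → Leaf → Set where
  atom-ver : ∀ {v} → Atom (ver v) 0 (ver-leaf v)
  atom-var : ∀ {i} → Atom (var i) 0 (var-leaf i)
  atom-⊕ˡ  : ∀ {m n d b} → Atom m d b → Atom (m ⊕ n) d b
  atom-⊕ʳ  : ∀ {m n d b} → Atom n d b → Atom (m ⊕ n) d b
  atom-a·  : ∀ {m d b} → Atom m d b → Atom (a · m) (suc d) b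

atom-≼ : ∀ {n d b} → Atom n d b → prefix d (leaf b) ≼ n
atom-≼ atom-ver     = ≼-refl
atom-≼ atom-var     = ≼-refl
atom-≼ (atom-⊕ˡ at) = ≼-trans (atom-≼ at) m≼m⊕n
atom-≼ (atom-⊕ʳ at) = ≼-trans (atom-≼ at) n≼m⊕n
atom-≼ (atom-a· at) = a·-mono-≼ (atom-≼ at)

prefix-≼-from-atoms : ∀ m k {n} → (∀ {d b} → Atom m d b → prefix (k + d) (leaf b) ≼ n) →
                      prefix k m ≼ n
prefix-≼-from-atoms (ver v) k {n} bound =
  subst (λ j → prefix j (ver v) ≼ n) (+-identityʳ k) (bound atom-ver)
prefix-≼-from-atoms (var i) k {n} bound =
  subst (λ j → prefix j (var i) ≼ n) (+-identityʳ k) (bound atom-var)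
prefix-≼-from-atoms (m₁ ⊕ m₂) k bound =
  ≼-trans (≋⇒≼ (prefix-distrib-⊕ k m₁ m₂))
          (⊕-lub (prefix-≼-from-atoms m₁ k (bound ∘ atom-⊕ˡ))
                 (prefix-≼-from-atoms m₂ k (bound ∘ atom-⊕ʳ)))
prefix-≼-from-atoms (b · m) k {n} bound =
  subst (_≼ n) (sym (prefix-suc k m))
    (prefix-≼-from-atoms m (suc k)
      (λ {d} {c} at → subst (λ j → prefix j (leaf c) ≼ n) (+-suc k d) (bound (atom-a· at))))

≼-from-atoms : ∀ {m n} → (∀ {d b} → Atom m d b → prefix d (leaf b) ≼ n) → m ≼ n
≼-from-atoms {m} bound = prefix-≼-from-atoms m 0 bound

atom-eval-≤∞ : ∀ {f ρ m d b k} → Atom m d b → eval f ρ (leaf b) ≡ fin k →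
               eval f ρ m ≤∞ fin (d + k)
atom-eval-≤∞                 atom-ver     eq = ≤∞-reflexive eq
atom-eval-≤∞                 atom-var     eq = ≤∞-reflexive eq
atom-eval-≤∞ {f} {ρ} {m ⊕ n} (atom-⊕ˡ at) eq = ≤∞-trans (p⊓∞q≤∞p (eval f ρ m) _) (atom-eval-≤∞ at eq)
atom-eval-≤∞ {f} {ρ} {m ⊕ n} (atom-⊕ʳ at) eq = ≤∞-trans (p⊓∞q≤∞q (eval f ρ m) _) (atom-eval-≤∞ at eq)
atom-eval-≤∞                 (atom-a· at) eq = suc∞-mono-≤∞ (atom-eval-≤∞ at eq)

eval-≤∞-attained : ∀ f ρ m {d} → eval f ρ m ≤∞ fin d →
                   ∃[ e ] ∃[ b ] ∃[ k ] Atom m e b × eval f ρ (leaf b) ≡ fin k × e + k ≤ d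
eval-≤∞-attained f ρ (ver v) le with ≤∞-fin-inv le
... | k , eq , k≤d = 0 , ver-leaf v , k , atom-ver , eq , k≤d
eval-≤∞-attained f ρ (var i) le with ≤∞-fin-inv le
... | k , eq , k≤d = 0 , var-leaf i , k , atom-var , eq , k≤d
eval-≤∞-attained f ρ (m ⊕ n) le with ⊓∞-≤∞-fin-cases (eval f ρ m) (eval f ρ n) le
... | inj₁ le-m with eval-≤∞-attained f ρ m le-m
...   | e , b , k , at , eq , e+k≤d = e , b , k , atom-⊕ˡ at , eq , e+k≤d
eval-≤∞-attained f ρ (m ⊕ n) le | inj₂ le-n with eval-≤∞-attained f ρ n le-n
...   | e , b , k , at , eq , e+k≤d = e , b , k , atom-⊕ʳ at , eq , e+k≤d
eval-≤∞-attained f ρ (c · m) {zero}  le = ⊥-elim (suc∞p≰∞0 le)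
eval-≤∞-attained f ρ (c · m) {suc d} le with eval-≤∞-attained f ρ m (suc∞-≤∞-suc-inv le)
... | e , b , k , at , eq , e+k≤d = suc e , b , k , atom-a· at , eq , s≤s e+k≤d

-- Completeness

Included : Verdict → Mon → Mon → Set
Included w m n = ∀ σ → ClosedSubst σ → ∀ s → Weak (sub σ m) s (ver w) → Weak (sub σ n) s (ver w)

included⇒depth-≤∞ : ∀ {w m n σ d} → Included w m n → ClosedSubst σ →
                    depth w (sub σ m) ≤∞ fin d → depth w (sub σ n) ≤∞ fin d
included⇒depth-≤∞ {w} {m} {n} {σ} {d} incl cl le =
  subst (λ j → depth w (sub σ n) ≤∞ fin j) length-trace
    (weak⇒depth≤ (incl σ cl trace
      (depth≤⇒weak (sub σ m) trace w (subst (λ j → depth w (sub σ m) ≤∞ fin j) (sym length-trace) le))))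
  where
  trace = replicate d tt
  length-trace : length trace ≡ d
  length-trace = length-replicate d

atom-transfer : ∀ {w m n σ d b} → Included w m n → ClosedSubst σ → Atom m d b →
                depthUnder w σ (leaf b) ≡ fin 0 →
                ∃[ e ] ∃[ b′ ] ∃[ k ] Atom n e b′ × depthUnder w σ (leaf b′) ≡ fin k × e + k ≤ d
atom-transfer {w} {m} {n} {σ} {d} incl cl at eq =
  eval-≤∞-attained _ _ n (subst (_≤∞ fin d) (depth-sub w σ n) n-within)
  where
  m-within : depthUnder w σ m ≤∞ fin d
  m-within = subst (λ j → depthUnder w σ m ≤∞ fin j) (+-identityʳ d) (atom-eval-≤∞ at eq)
  n-within : depth w (sub σ n) ≤∞ fin d
  n-within = included⇒depth-≤∞ {m = m} {n} incl cl (subst (_≤∞ fin d) (sym (depth-sub w σ m)) m-within)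

verdict-atom-transfer : ∀ {w m n d} → w ≢ end → Included w m n → Atom m d (ver-leaf w) →
                        ∃[ e ] e ≤ d × Atom n e (ver-leaf w)
verdict-atom-transfer {w} w≢end incl at
  with atom-transfer {σ = const (ver end)} incl (λ _ → c-ver) at (verdictDepth-refl w)
... | e , ver-leaf v , k , at′ , eq , e+k≤d with verdictDepth-fin⇒≡ w v eq
...   | refl = e , m+n≤o⇒m≤o e e+k≤d , at′
verdict-atom-transfer {w} w≢end incl at
    | e , var-leaf j , k , at′ , eq , e+k≤d = ⊥-elim (w≢end (sym (verdictDepth-fin⇒≡ w end eq)))

point : ℕ → Verdict → Subst
point i w j with j ≟ℕ i
... | Dec.yes _ = ver w
... | Dec.no  _ = ver end

point-closed : ∀ i w → ClosedSubst (point i w)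
point-closed i w j with j ≟ℕ i
... | Dec.yes _ = c-ver
... | Dec.no  _ = c-ver

point-self : ∀ i w → point i w i ≡ ver w
point-self i w with i ≟ℕ i
... | Dec.yes _   = refl
... | Dec.no  i≢i = ⊥-elim (i≢i refl)

point-depth-fin : ∀ {i w j k} → w ≢ end → depth w (point i w j) ≡ fin k → j ≡ i
point-depth-fin {i} {w} {j} w≢end eq with j ≟ℕ i
... | Dec.yes j≡i = j≡i
... | Dec.no  _   = ⊥-elim (w≢end (sym (verdictDepth-fin⇒≡ w end eq)))

variable-atom-transfer : ∀ {w m n d i} → w ≢ end → Included w m n → Atom m d (var-leaf i) →
                         ∃[ e ] e ≤ d × (Atom n e (var-leaf i) ⊎ Atom n e (ver-leaf w))
variable-atom-transfer {w} {i = i} w≢end incl at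
  with atom-transfer {σ = point i w} incl (point-closed i w) at
         (trans (cong (depth w) (point-self i w)) (verdictDepth-refl w))
... | e , ver-leaf v , k , at′ , eq , e+k≤d with verdictDepth-fin⇒≡ w v eq
...   | refl = e , m+n≤o⇒m≤o e e+k≤d , inj₂ at′
variable-atom-transfer {w} {i = i} w≢end incl at
    | e , var-leaf j , k , at′ , eq , e+k≤d with point-depth-fin {i} {w} {j} w≢end eq
...   | refl = e , m+n≤o⇒m≤o e e+k≤d , inj₁ at′

shallower-atom-≼ : ∀ {n e d b} → a · leaf b ≼ leaf b → e ≤ d → Atom n e b → prefix d (leaf b) ≼ n
shallower-atom-≼ absorbs e≤d at = ≼-trans (prefix-antitone absorbs e≤d) (atom-≼ at)

atom-≼-included : ∀ {m n d b} → Included yes m n → Included no m n → Atom m d b →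
                  prefix d (leaf b) ≼ n
atom-≼-included {d = d} {ver-leaf end} _ _ _ = ≼-trans (≋⇒≼ (prefix-end d)) end≼
atom-≼-included {b = ver-leaf yes} incl-yes _ at with verdict-atom-transfer (λ ()) incl-yes at
... | e , e≤d , at′ = shallower-atom-≼ yes-absorbs-a· e≤d at′
atom-≼-included {b = ver-leaf no} _ incl-no at with verdict-atom-transfer (λ ()) incl-no at
... | e , e≤d , at′ = shallower-atom-≼ no-absorbs-a· e≤d at′
atom-≼-included {d = d} {var-leaf i} incl-yes incl-no at
  with variable-atom-transfer (λ ()) incl-yes at | variable-atom-transfer (λ ()) incl-no at
... | e , e≤d , inj₁ at′ | _ = shallower-atom-≼ (var-absorbs-a· i) e≤d at′
... | _ | e , e≤d , inj₁ at′ = shallower-atom-≼ (var-absorbs-a· i) e≤d at′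
... | e , e≤d , inj₂ at-yes | e′ , e′≤d , inj₂ at-no =
  ≼-trans (prefix-mono-≼ d (≼-yes⊕no (var i)))
    (≼-trans (≋⇒≼ (prefix-distrib-⊕ d (ver yes) (ver no)))
      (⊕-lub (shallower-atom-≼ yes-absorbs-a· e≤d at-yes)
             (shallower-atom-≼ no-absorbs-a· e′≤d at-no)))

included⇒≼ : ∀ {m n} → Included yes m n → Included no m n → m ≼ n
included⇒≼ incl-yes incl-no = ≼-from-atoms (atom-≼-included incl-yes incl-no)

completeness : ∀ (m n : Mon) → m ≃ n → Ev1' ⊢ m ≈ n
completeness m n m≃n =
  ≼-antisym (included⇒≼ (λ σ cl s → Equivalence.to   (proj₁ (m≃n σ cl) s))
                        (λ σ cl s → Equivalence.to   (proj₂ (m≃n σ cl) s)))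
            (included⇒≼ (λ σ cl s → Equivalence.from (proj₁ (m≃n σ cl) s))
                        (λ σ cl s → Equivalence.from (proj₂ (m≃n σ cl) s)))

theorem6 : (∀ (m n : Mon) → Ev1' ⊢ m ≈ n → m ≃ n)
           × (∀ (m n : Mon) → m ≃ n → Ev1' ⊢ m ≈ n)
theorem6 = soundness , completeness
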